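{- Let $\boldsymbol{\alpha}=(\alpha_i)_{i\in\mathbb{Z}}$ be commuting indeterminates. For all $k,\ell\in\mathbb{Z}$, \[ \varphi(J^{(\boldsymbol{\alpha})}_k, J^{(\boldsymbol{\alpha})}_{\ell}) = \begin{cases} k & \text{if $\ell = - k$,}\\ 0 & \text{otherwise}. \end{cases} \]
   Context: Let $\overline{\mathfrak{a}}_{\infty}^+$ be the set of $\mathbb{Z}\times\mathbb{Z}$ matrices $A=(a_{ij})$ with entries in $\mathbb{C}[\boldsymbol{\alpha}]$ such that for some $N$ (depending on $A$), $a_{ij}=0$ unless $i-j<N$. For $A=(a_{ij}),B=(b_{ij})\in\overline{\mathfrak{a}}_{\infty}^+$ define the (finite) sum \[ \varphi(A,B)=\sum_{\substack{i \leqslant 0 \\ j > 0}} a_{ij}b_{ji} - \sum_{\substack{i > 0\\ j \leqslant 0}} a_{ij}b_{ji}. \] For $i,j,k\in\mathbb{Z}$ set \[ A_{ij}^k = \begin{cases} e_{j-i-k}(-\alpha_{i+1},\dots,-\alpha_{j-1}) & \text{if } j \geqslant i + k \text{ and } k > 0, \\ h_{j-i-k}(\alpha_j,\dots,\alpha_i) & \text{if } j \leqslant i \leqslant j - k \text{ and } k \leqslant 0, \\ 0 & \text{otherwise,} \end{cases} \] where $e_r,h_r$ are the elementary and complete homogeneous symmetric polynomials in the listed variables ($e_0=h_0=1$, and $e_r$ of an empty list is $0$ for $r>0$), and let $J_k^{(\boldsymbol{\alpha})}=(A^k_{ij})_{i,j\in\mathbb{Z}}\in\overline{\mathfrak{a}}_{\infty}^+$.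 -}

module Defs where

open import Level using (Level)
open import Algebra.Bundles using (CommutativeRing)
open import Data.Nat as ℕ using (ℕ; zero; suc)
open import Data.Integer as ℤ using (ℤ; +_; -[1+_]; ∣_∣)
open import Data.List using (List; []; _∷_; map)
open import Data.Bool using (Bool; true; false; if_then_else_; _∧_)
open import Relation.Nullary.Decidable using (⌊_⌋)

range : ℤ → ℕ → List ℤ
range a zero    = []
range a (suc n) = a ∷ range (a ℤ.+ + 1) n

module _ {c ℓ : Level} (R : CommutativeRing c ℓ) where
  open CommutativeRing R

  natCast : ℕ → Carrier
  natCast zero    = 0#
  natCast (suc n) = 1# + natCast n

  intCast : ℤ → Carrier
  intCast (+ n)      = natCast n
  intCast -[1+ n ]   = - natCast (suc n)

  elem : ℕ → List Carrier → Carrier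
  elem zero    _        = 1#
  elem (suc r) []       = 0#
  elem (suc r) (x ∷ xs) = elem (suc r) xs + x * elem r xs

  comp : ℕ → List Carrier → Carrier
  comp zero    _        = 1#
  comp (suc r) []       = 0#
  comp (suc r) (x ∷ xs) = comp (suc r) xs + x * comp r (x ∷ xs)

  Mat : Set c
  Mat = ℤ → ℤ → Carrier

  -- A ∈ \bar{a}^+_∞ witnessed by the bound N: a_ij = 0 unless i - j < N
  BoundedBy : ℕ → Mat → Set ℓ
  BoundedBy N A = ∀ i j → (+ N) ℤ.≤ (i ℤ.- j) → A i j ≈ 0#

  sumTo : ℕ → (ℕ → Carrier) → Carrier
  sumTo zero    f = 0#
  sumTo (suc n) f = sumTo n f + f n

  -- First sum (i ≤ 0 < j): only b_ji with j - i < NB can be nonzero; write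
  --   d = j - i ∈ [1, NB), i = -t, j = d - t with 0 ≤ t < d.
  -- Second sum (j ≤ 0 < i): only a_ij with i - j < NA can be nonzero; write
  --   d = i - j ∈ [1, NA), j = -t, i = d - t with 0 ≤ t < d.
  φ : ℕ → ℕ → Mat → Mat → Carrier
  φ NA NB A B =
      sumTo NB (λ d → sumTo d (λ t →
        let i = ℤ.- (+ t) ; j = (+ d) ℤ.- (+ t) in A i j * B j i))
    - sumTo NA (λ d → sumTo d (λ t →
        let j = ℤ.- (+ t) ; i = (+ d) ℤ.- (+ t) in A i j * B j i))

  J : (ℤ → Carrier) → ℤ → Mat
  J α k i j =
    if ⌊ (+ 0) ℤ.<? k ⌋
    then (if ⌊ (i ℤ.+ k) ℤ.≤? j ⌋
          then elem ∣ j ℤ.- i ℤ.- k ∣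
                    (map (λ m → - α m) (range (i ℤ.+ + 1) ∣ j ℤ.- i ℤ.- + 1 ∣))
          else 0#)
    else (if ⌊ j ℤ.≤? i ⌋ ∧ ⌊ i ℤ.≤? (j ℤ.- k) ⌋
          then comp ∣ j ℤ.- i ℤ.- k ∣ (map α (range j (suc ∣ i ℤ.- j ∣)))
          else 0#)

-- J_{-1} is the bidiagonal matrix L = diag(α) + (ones on the subdiagonal), and the recursions
-- e_r(x, xs) = e_r(xs) + x e_{r-1}(xs) and h_r(x, xs) = h_r(xs) + x h_{r-1}(x, xs) say that
-- J_k = L J_{k+1} = J_{k+1} L for k ≥ 0 and J_{-m-1} = L J_{-m} = J_{-m} L, on the entries that matter.
-- Summation by parts in the row index turns the first sum of φ(J_{k+1}, J_{-m-1}) into that of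
-- φ(J_k, J_{-m}) plus the boundary term Σ_{j>0} (J_{k+1})_{0j} (J_{-m})_{j1}, which the same argument
-- along the column reduces to δ_{km}; as J_0 = 1, induction gives k δ_{km}, while the second sum
-- vanishes because J_k is upper triangular. In all other sign patterns J_k and J_l are triangular on
-- the same side and both sums of φ vanish term by term.
module Submission where

open import Defs
open import Algebra.Bundles using (CommutativeRing)
open import Data.Nat as ℕ using (ℕ; zero; suc; z≤n; s≤s)
import Data.Nat.Properties as ℕ
open import Data.Integer as ℤ using (ℤ; +_; -[1+_]; ∣_∣; _⊖_)
import Data.Integer.Properties as ℤ
open import Data.List using (List; []; _∷_; _∷ʳ_; map; length)
open import Data.List.Properties using (length-map; map-++)
open import Data.Sum using (inj₁; inj₂)
open import Relation.Binary.PropositionalEquality as ≡ using (_≡_; _≢_; cong; cong₂)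
open import Data.Empty using (⊥-elim)
open import Relation.Nullary using (¬_; yes; no)
open import Relation.Nullary.Decidable using (⌊_⌋)
open import Data.Bool using (false; if_then_else_)
open import Function using (case_of_; _∘_)
open import Data.Integer.Tactic.RingSolver using (solve-∀)

i<i+[1+n] : ∀ i n → i ℤ.< i ℤ.+ + suc n
i<i+[1+n] i n = ≡.subst (ℤ._< i ℤ.+ + suc n) (ℤ.+-identityʳ i) (ℤ.+-monoʳ-< i (ℤ.+<+ (s≤s z≤n)))

i+[1+n]≰i : ∀ i n → ¬ (i ℤ.+ + suc n ℤ.≤ i)
i+[1+n]≰i i n = ℤ.<⇒≱ (i<i+[1+n] i n)

-- The solver does not see through ℤ.suc and ℤ.pred, so the identities below are proved for 1 + x and -1 + x.
[i+n]-i≡n : ∀ i n → i ℤ.+ + n ℤ.- i ≡ + n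
[i+n]-i≡n i n = identity i (+ n)
  where identity : ∀ i x → i ℤ.+ x ℤ.- i ≡ x
        identity = solve-∀

pred[i]+[1+n]≡i+n : ∀ i n → ℤ.pred i ℤ.+ + suc n ≡ i ℤ.+ + n
pred[i]+[1+n]≡i+n i n = identity i (+ n)
  where identity : ∀ i x → (ℤ.- + 1 ℤ.+ i) ℤ.+ (+ 1 ℤ.+ x) ≡ i ℤ.+ x
        identity = solve-∀

suc[i]+n≡i+[1+n] : ∀ i n → ℤ.suc i ℤ.+ + n ≡ i ℤ.+ + suc n
suc[i]+n≡i+[1+n] i n = identity i (+ n)
  where identity : ∀ i x → (+ 1 ℤ.+ i) ℤ.+ x ≡ i ℤ.+ (+ 1 ℤ.+ x)
        identity = solve-∀

suc[i+n]≡i+[1+n] : ∀ i n → ℤ.suc (i ℤ.+ + n) ≡ i ℤ.+ + suc n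
suc[i+n]≡i+[1+n] i n = identity i (+ n)
  where identity : ∀ i x → + 1 ℤ.+ (i ℤ.+ x) ≡ i ℤ.+ (+ 1 ℤ.+ x)
        identity = solve-∀

pred[i+[1+n]]≡i+n : ∀ i n → ℤ.pred (i ℤ.+ + suc n) ≡ i ℤ.+ + n
pred[i+[1+n]]≡i+n i n = identity i (+ n)
  where identity : ∀ i x → ℤ.- + 1 ℤ.+ (i ℤ.+ (+ 1 ℤ.+ x)) ≡ i ℤ.+ x
        identity = solve-∀

pred[m⊖n]≡m⊖[1+n] : ∀ m n → ℤ.pred (m ⊖ n) ≡ m ⊖ suc n
pred[m⊖n]≡m⊖[1+n] m n = ℤ.distribʳ-⊖-+-neg 0 m n

range-∷ : ∀ i n → range i (suc n) ≡ i ∷ range (ℤ.suc i) n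
range-∷ i n = cong (λ j → i ∷ range j n) (ℤ.+-comm i (+ 1))

range-∷ʳ : ∀ i n → range i (suc n) ≡ range i n ∷ʳ (i ℤ.+ + n)
range-∷ʳ i zero    = cong (_∷ []) (≡.sym (ℤ.+-identityʳ i))
range-∷ʳ i (suc n) =
  cong (i ∷_) (≡.trans (range-∷ʳ (i ℤ.+ + 1) n) (cong (range (i ℤ.+ + 1) n ∷ʳ_) (ℤ.+-assoc i (+ 1) (+ n))))

length-range : ∀ i n → length (range i n) ≡ n
length-range i zero    = ≡.refl
length-range i (suc n) = cong suc (length-range (i ℤ.+ + 1) n)

module _ {c ℓ} (R : CommutativeRing c ℓ) where
  open CommutativeRing R hiding (zero) renaming (refl to ≈-refl; sym to ≈-sym; trans to ≈-trans; reflexive to ≈-reflexive)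
  open import Relation.Binary.Reasoning.Setoid setoid
  open import Algebra.Properties.CommutativeSemigroup +-commutativeSemigroup using (interchange; xy∙z≈xz∙y; x∙yz≈xz∙y)
  open import Algebra.Properties.Ring ring using (-‿distribˡ-*; -0#≈0#)
  open import Algebra.Properties.AbelianGroup +-abelianGroup using (xyx⁻¹≈y)
  open import Algebra.Solver.Ring.NaturalCoefficients.Default commutativeSemiring using (solve; _:=_; _:+_; _:*_)

  -- Finite sums

  ∑ : ℕ → (ℕ → Carrier) → Carrier
  ∑ = sumTo R
  syntax ∑ n (λ d → e) = ∑[ d < n ] e

  ∑-cong : ∀ n {f g : ℕ → Carrier} → (∀ d → d ℕ.< n → f d ≈ g d) → ∑ n f ≈ ∑ n g
  ∑-cong zero    f≈g = ≈-refl
  ∑-cong (suc n) f≈g = +-cong (∑-cong n (λ d d<n → f≈g d (ℕ.m<n⇒m<1+n d<n))) (f≈g n ℕ.≤-refl)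

  ∑-zero : ∀ n (f : ℕ → Carrier) → (∀ d → d ℕ.< n → f d ≈ 0#) → ∑ n f ≈ 0#
  ∑-zero n f f≈0 = ≈-trans (∑-cong n f≈0) (∑-const-0 n)
    where
    ∑-const-0 : ∀ n → ∑[ d < n ] 0# ≈ 0#
    ∑-const-0 zero    = ≈-refl
    ∑-const-0 (suc n) = ≈-trans (+-identityʳ _) (∑-const-0 n)

  ∑-+ : ∀ n (f g : ℕ → Carrier) → ∑[ d < n ] (f d + g d) ≈ ∑ n f + ∑ n g
  ∑-+ zero    f g = ≈-sym (+-identityʳ 0#)
  ∑-+ (suc n) f g = ≈-trans (+-congʳ (∑-+ n f g)) (interchange _ _ _ _)

  ∑-suc : ∀ n (f : ℕ → Carrier) → ∑ (suc n) f ≈ f 0 + ∑[ d < n ] f (suc d)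
  ∑-suc zero    f = ≈-trans (+-identityˡ _) (≈-sym (+-identityʳ _))
  ∑-suc (suc n) f = ≈-trans (+-congʳ (∑-suc n f)) (+-assoc _ _ _)

  ∑-truncate : ∀ {N M} (f : ℕ → Carrier) → N ℕ.≤ M → (∀ d → N ℕ.≤ d → f d ≈ 0#) → ∑ M f ≈ ∑ N f
  ∑-truncate {M = zero}  f z≤n  f≈0 = ≈-refl
  ∑-truncate {M = suc M} f N≤1+M f≈0 with ℕ.m≤n⇒m<n∨m≡n N≤1+M
  ... | inj₂ ≡.refl = ≈-refl
  ... | inj₁ N<1+M  = ≈-trans (+-cong (∑-truncate f N≤M f≈0) (f≈0 M N≤M)) (+-identityʳ _)
    where N≤M = ℕ.≤-pred N<1+M

  -- Symmetric polynomials of integer degree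

  -- e_r and h_r vanish for r < 0; with this convention their recursions hold in every integer degree.
  extendℤ : (ℕ → Carrier) → ℤ → Carrier
  extendℤ f (+ n)    = f n
  extendℤ f -[1+ n ] = 0#

  elemᶻ compᶻ : ℤ → List Carrier → Carrier
  elemᶻ d xs = extendℤ (λ r → elem R r xs) d
  compᶻ d xs = extendℤ (λ r → comp R r xs) d

  extendℤ-negative : ∀ f {d} → d ℤ.< + 0 → extendℤ f d ≡ 0#
  extendℤ-negative f { -[1+ n ]} _          = ≡.refl
  extendℤ-negative f {+ n}       (ℤ.+<+ ())

  if-≤?-extendℤ : ∀ {x y z} (f : ℕ → Carrier) → z ≡ y ℤ.- x →
                  (if ⌊ x ℤ.≤? y ⌋ then f ∣ z ∣ else 0#) ≡ extendℤ f z
  if-≤?-extendℤ {x} {y} {z} f z≡y-x with x ℤ.≤? y | z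
  ... | yes _   | + n      = ≡.refl
  ... | no  x≰y | + n      = ⊥-elim (x≰y (ℤ.0≤i-j⇒j≤i (≡.subst (+ 0 ℤ.≤_) z≡y-x (ℤ.+≤+ z≤n))))
  ... | yes x≤y | -[1+ n ] = case ≡.subst (+ 0 ℤ.≤_) (≡.sym z≡y-x) (ℤ.i≤j⇒0≤j-i x≤y) of λ ()
  ... | no  _   | -[1+ n ] = ≡.refl

  elem-length : ∀ r xs → length xs ℕ.< r → elem R r xs ≈ 0#
  elem-length (suc r) []       _             = ≈-refl
  elem-length (suc r) (x ∷ xs) (s≤s len<1+r) = begin
    elem R (suc r) xs + x * elem R r xs ≈⟨ +-cong (elem-length (suc r) xs (ℕ.m<n⇒m<1+n len<1+r))
                                                  (*-congˡ (elem-length r xs len<1+r)) ⟩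
    0# + x * 0#                         ≈⟨ +-identityˡ _ ⟩
    x * 0#                              ≈⟨ zeroʳ x ⟩
    0#                                  ∎

  private
    1≈1+x*0 : ∀ x → 1# ≈ 1# + x * 0#
    1≈1+x*0 x = ≈-sym (≈-trans (+-congˡ (zeroʳ x)) (+-identityʳ 1#))

    0≈0+x*0 : ∀ x → 0# ≈ 0# + x * 0#
    0≈0+x*0 x = ≈-sym (≈-trans (+-congˡ (zeroʳ x)) (+-identityʳ 0#))

    a*b+[c-a*b]≈c : ∀ a b c → a * b + (c + - a * b) ≈ c
    a*b+[c-a*b]≈c a b c = begin
      a * b + (c + - a * b)   ≈⟨ +-congˡ (+-congˡ (≈-sym (-‿distribˡ-* a b))) ⟩
      a * b + (c + - (a * b)) ≈⟨ ≈-sym (+-assoc _ _ _) ⟩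
      a * b + c + - (a * b)   ≈⟨ xyx⁻¹≈y _ _ ⟩
      c                       ∎

    exchange : ∀ a b c d x y → (a + x * b) + y * (c + x * d) ≈ (a + y * c) + x * (b + y * d)
    exchange = solve 6 (λ a b c d x y → (a :+ x :* b) :+ y :* (c :+ x :* d)
                                    := (a :+ y :* c) :+ x :* (b :+ y :* d)) ≈-refl

  elemᶻ-∷ : ∀ d x xs → elemᶻ d (x ∷ xs) ≈ elemᶻ d xs + x * elemᶻ (ℤ.pred d) xs
  elemᶻ-∷ (+ zero)  x xs = 1≈1+x*0 x
  elemᶻ-∷ (+ suc r) x xs = ≈-refl
  elemᶻ-∷ -[1+ n ]  x xs = 0≈0+x*0 x

  elemᶻ-∷ʳ : ∀ d xs x → elemᶻ d (xs ∷ʳ x) ≈ elemᶻ d xs + x * elemᶻ (ℤ.pred d) xs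
  elemᶻ-∷ʳ d []       x = elemᶻ-∷ d x []
  elemᶻ-∷ʳ d (y ∷ ys) x = begin
    elemᶻ d (y ∷ ys ∷ʳ x)
      ≈⟨ elemᶻ-∷ d y (ys ∷ʳ x) ⟩
    elemᶻ d (ys ∷ʳ x) + y * elemᶻ (ℤ.pred d) (ys ∷ʳ x)
      ≈⟨ +-cong (elemᶻ-∷ʳ d ys x) (*-congˡ (elemᶻ-∷ʳ (ℤ.pred d) ys x)) ⟩
    (elemᶻ d ys + x * elemᶻ (ℤ.pred d) ys) + y * (elemᶻ (ℤ.pred d) ys + x * elemᶻ (ℤ.pred (ℤ.pred d)) ys)
      ≈⟨ exchange _ _ _ _ x y ⟩
    (elemᶻ d ys + y * elemᶻ (ℤ.pred d) ys) + x * (elemᶻ (ℤ.pred d) ys + y * elemᶻ (ℤ.pred (ℤ.pred d)) ys)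
      ≈⟨ ≈-sym (+-cong (elemᶻ-∷ d y ys) (*-congˡ (elemᶻ-∷ (ℤ.pred d) y ys))) ⟩
    elemᶻ d (y ∷ ys) + x * elemᶻ (ℤ.pred d) (y ∷ ys) ∎

  compᶻ-∷ : ∀ d x xs → compᶻ d (x ∷ xs) ≈ compᶻ d xs + x * compᶻ (ℤ.pred d) (x ∷ xs)
  compᶻ-∷ (+ zero)  x xs = 1≈1+x*0 x
  compᶻ-∷ (+ suc r) x xs = ≈-refl
  compᶻ-∷ -[1+ n ]  x xs = 0≈0+x*0 x

  comp-∷ʳ : ∀ r xs x → comp R (suc r) (xs ∷ʳ x) ≈ comp R (suc r) xs + x * comp R r (xs ∷ʳ x)
  comp-∷ʳ r       []       x = ≈-refl
  comp-∷ʳ zero    (y ∷ ys) x = ≈-trans (+-congʳ (comp-∷ʳ zero ys x)) (xy∙z≈xz∙y _ _ _)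
  comp-∷ʳ (suc r) (y ∷ ys) x = begin
    comp R (2 ℕ.+ r) (ys ∷ʳ x) + y * comp R (suc r) (y ∷ ys ∷ʳ x)
      ≈⟨ +-cong (comp-∷ʳ (suc r) ys x) (*-congˡ (comp-∷ʳ r (y ∷ ys) x)) ⟩
    (comp R (2 ℕ.+ r) ys + x * comp R (suc r) (ys ∷ʳ x)) + y * (comp R (suc r) (y ∷ ys) + x * comp R r (y ∷ ys ∷ʳ x))
      ≈⟨ exchange _ _ _ _ x y ⟩
    (comp R (2 ℕ.+ r) ys + y * comp R (suc r) (y ∷ ys)) + x * (comp R (suc r) (ys ∷ʳ x) + y * comp R r (y ∷ ys ∷ʳ x)) ∎

  compᶻ-∷ʳ : ∀ d xs x → compᶻ d (xs ∷ʳ x) ≈ compᶻ d xs + x * compᶻ (ℤ.pred d) (xs ∷ʳ x)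
  compᶻ-∷ʳ (+ zero)  xs x = 1≈1+x*0 x
  compᶻ-∷ʳ (+ suc r) xs x = comp-∷ʳ r xs x
  compᶻ-∷ʳ -[1+ n ]  xs x = 0≈0+x*0 x

  -- The sums in φ

  ∑△ : ℕ → (ℕ → ℕ → Carrier) → Carrier
  ∑△ N f = ∑[ d < N ] ∑[ t < d ] f d t

  ∑△-cong : ∀ N {f g : ℕ → ℕ → Carrier} → (∀ d t → t ℕ.< d → f d t ≈ g d t) → ∑△ N f ≈ ∑△ N g
  ∑△-cong N f≈g = ∑-cong N λ d _ → ∑-cong d (f≈g d)

  ∑△-zero : ∀ N (f : ℕ → ℕ → Carrier) → (∀ d t → t ℕ.< d → f d t ≈ 0#) → ∑△ N f ≈ 0#
  ∑△-zero N f f≈0 = ∑-zero N _ λ d _ → ∑-zero d (f d) (f≈0 d)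

  ∑△-+ : ∀ N (f g : ℕ → ℕ → Carrier) → ∑△ N (λ d t → f d t + g d t) ≈ ∑△ N f + ∑△ N g
  ∑△-+ N f g = ≈-trans (∑-cong N λ d _ → ∑-+ d (f d) (g d)) (∑-+ N _ _)

  ∑△-suc : ∀ N (f : ℕ → ℕ → Carrier) →
           ∑△ (suc N) f ≈ ∑[ d < N ] f (suc d) 0 + ∑△ N (λ d t → f (suc d) (suc t))
  ∑△-suc N f = begin
    ∑△ (suc N) f                                                       ≈⟨ ∑-suc N _ ⟩
    0# + ∑[ d < N ] ∑[ t < suc d ] f (suc d) t                         ≈⟨ +-identityˡ _ ⟩
    ∑[ d < N ] ∑[ t < suc d ] f (suc d) t                              ≈⟨ ∑-cong N (λ d _ → ∑-suc d _) ⟩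
    ∑[ d < N ] (f (suc d) 0 + ∑[ t < d ] f (suc d) (suc t))            ≈⟨ ∑-+ N _ _ ⟩
    ∑[ d < N ] f (suc d) 0 + ∑△ N (λ d t → f (suc d) (suc t))          ∎

  UpperTriangular LowerTriangular : Mat R → Set ℓ
  UpperTriangular A = ∀ i n → A (i ℤ.+ + suc n) i ≈ 0#
  LowerTriangular A = ∀ i n → A i (i ℤ.+ + suc n) ≈ 0#

  bounded-vanishes : ∀ {N d B} → BoundedBy R N B → N ℕ.≤ d → ∀ i → B (i ℤ.+ + d) i ≈ 0#
  bounded-vanishes {N} {d} B-bounded N≤d i =
    B-bounded _ i (≡.subst (+ N ℤ.≤_) (≡.sym ([i+n]-i≡n i d)) (ℤ.+≤+ N≤d))

  -- The pair (i, j) = (-t, -t + d) runs over i ≤ 0 < j, j - i = d, as in the first sum of φ.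
  cutTerm : Mat R → Mat R → ℕ → ℕ → Carrier
  cutTerm A B d t = let i = ℤ.- + t in A i (i ℤ.+ + d) * B (i ℤ.+ + d) i

  cutSum : ℕ → Mat R → Mat R → Carrier
  cutSum N A B = ∑△ N (cutTerm A B)

  edgeSum : ℕ → Mat R → Mat R → Carrier
  edgeSum N A B = ∑[ d < N ] (A (+ 0) (+ suc d) * B (+ suc d) (+ 1))

  φ≈cutSum-cutSum : ∀ NA NB A B → φ R NA NB A B ≈ cutSum NB A B - cutSum NA B A
  φ≈cutSum-cutSum NA NB A B =
    +-cong (∑△-cong NB λ d t _ → ≈-reflexive (reindex A B d t))
           (-‿cong (∑△-cong NA λ d t _ → ≈-trans (*-comm _ _) (≈-reflexive (reindex B A d t))))
    where
    reindex : ∀ A B d t → A (ℤ.- + t) (+ d ℤ.- + t) * B (+ d ℤ.- + t) (ℤ.- + t) ≡ cutTerm A B d t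
    reindex A B d t = cong (λ j → A (ℤ.- + t) j * B j (ℤ.- + t)) (ℤ.+-comm (+ d) (ℤ.- + t))

  cutSum-cong : ∀ N A A′ B B′ → (∀ i n → A i (i ℤ.+ + suc n) ≈ A′ i (i ℤ.+ + suc n)) →
                (∀ i n → B (i ℤ.+ + suc n) i ≈ B′ (i ℤ.+ + suc n) i) → cutSum N A B ≈ cutSum N A′ B′
  cutSum-cong N A A′ B B′ A≈A′ B≈B′ = ∑△-cong N term
    where
    term : ∀ d t → t ℕ.< d → cutTerm A B d t ≈ cutTerm A′ B′ d t
    term (suc n) t _ = *-cong (A≈A′ _ n) (B≈B′ _ n)

  edgeSum-cong : ∀ N A A′ B B′ → (∀ n → A (+ 0) (+ suc n) ≈ A′ (+ 0) (+ suc n)) →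
                 (∀ n → B (+ suc n) (+ 1) ≈ B′ (+ suc n) (+ 1)) → edgeSum N A B ≈ edgeSum N A′ B′
  edgeSum-cong N A A′ B B′ A≈A′ B≈B′ = ∑-cong N λ d _ → *-cong (A≈A′ d) (B≈B′ d)

  cutSum-lower : ∀ N A B → LowerTriangular A → cutSum N A B ≈ 0#
  cutSum-lower N A B A-lower = ∑△-zero N _ term
    where
    term : ∀ d t → t ℕ.< d → cutTerm A B d t ≈ 0#
    term (suc n) t _ = ≈-trans (*-congʳ (A-lower _ n)) (zeroˡ _)

  cutSum-upper : ∀ N A B → UpperTriangular B → cutSum N A B ≈ 0#
  cutSum-upper N A B B-upper = ∑△-zero N _ term
    where
    term : ∀ d t → t ℕ.< d → cutTerm A B d t ≈ 0#
    term (suc n) t _ = ≈-trans (*-congˡ (B-upper _ n)) (zeroʳ _)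

  cutSum-beyond-bound : ∀ {K} A {B} → BoundedBy R K B → ∀ d → K ℕ.≤ d → ∑[ t < d ] cutTerm A B d t ≈ 0#
  cutSum-beyond-bound A B-bounded d K≤d =
    ∑-zero d _ λ t _ → ≈-trans (*-congˡ (bounded-vanishes B-bounded K≤d (ℤ.- + t))) (zeroʳ _)

  cutSum-bound-irrelevant : ∀ {N M} A {B} → BoundedBy R N B → BoundedBy R M B → cutSum N A B ≈ cutSum M A B
  cutSum-bound-irrelevant {N} {M} A N-bound M-bound with ℕ.≤-total N M
  ... | inj₁ N≤M = ≈-sym (∑-truncate _ N≤M (cutSum-beyond-bound A N-bound))
  ... | inj₂ M≤N = ∑-truncate _ M≤N (cutSum-beyond-bound A M-bound)

  φ-upper : ∀ NA NB A B → UpperTriangular A → UpperTriangular B → φ R NA NB A B ≈ 0#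
  φ-upper NA NB A B A-upper B-upper = begin
    φ R NA NB A B                 ≈⟨ φ≈cutSum-cutSum NA NB A B ⟩
    cutSum NB A B - cutSum NA B A ≈⟨ +-cong (cutSum-upper NB A B B-upper) (-‿cong (cutSum-upper NA B A A-upper)) ⟩
    0# - 0#                       ≈⟨ -‿inverseʳ 0# ⟩
    0#                            ∎

  φ-lower : ∀ NA NB A B → LowerTriangular A → LowerTriangular B → φ R NA NB A B ≈ 0#
  φ-lower NA NB A B A-lower B-lower = begin
    φ R NA NB A B                 ≈⟨ φ≈cutSum-cutSum NA NB A B ⟩
    cutSum NB A B - cutSum NA B A ≈⟨ +-cong (cutSum-lower NB A B A-lower) (-‿cong (cutSum-lower NA B A B-lower)) ⟩
    0# - 0#                       ≈⟨ -‿inverseʳ 0# ⟩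
    0#                            ∎

  L[_]·_ : (ℤ → Carrier) → Mat R → Mat R
  (L[ a ]· M) i j = a i * M i j + M (ℤ.pred i) j

  _·L[_] : Mat R → (ℤ → Carrier) → Mat R
  (M ·L[ a ]) i j = M i j * a j + M i (ℤ.suc j)

  -- Summation by parts in the row index i: the terms A_{ij} B_{j,i+1} and A_{i-1,j} B_{ji} cancel
  -- against each other except in the row i = 0, which is edgeSum.
  cutSum-telescope : ∀ N a A B → BoundedBy R N B →
                     cutSum (suc N) A (B ·L[ a ]) ≈ cutSum N (L[ a ]· A) B + edgeSum N A B
  cutSum-telescope N a A B B-bounded = begin
    cutSum (suc N) A (B ·L[ a ])
      ≈⟨ ∑△-cong (suc N) (λ d t _ → split d t) ⟩
    ∑△ (suc N) (λ d t → diagonal d t + right d t)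
      ≈⟨ ∑△-+ (suc N) diagonal right ⟩
    ∑△ (suc N) diagonal + ∑△ (suc N) right
      ≈⟨ +-cong drop-last (∑△-suc N right) ⟩
    ∑△ N diagonal + (edgeSum N A B + ∑△ N (λ d t → right (suc d) (suc t)))
      ≈⟨ +-congˡ (+-congˡ (∑△-cong N λ d t _ → ≈-reflexive (shift d t))) ⟩
    ∑△ N diagonal + (edgeSum N A B + ∑△ N left)
      ≈⟨ x∙yz≈xz∙y _ _ _ ⟩
    (∑△ N diagonal + ∑△ N left) + edgeSum N A B
      ≈⟨ +-congʳ (≈-sym (≈-trans (∑△-cong N λ d t _ → merge d t) (∑△-+ N diagonal left))) ⟩
    cutSum N (L[ a ]· A) B + edgeSum N A B ∎
    where
    i : ℕ → ℤ
    i t = ℤ.- + t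
    diagonal right left : ℕ → ℕ → Carrier
    diagonal d t = a (i t) * cutTerm A B d t
    right    d t = A (i t) (i t ℤ.+ + d) * B (i t ℤ.+ + d) (ℤ.suc (i t))
    left     d t = A (ℤ.pred (i t)) (i t ℤ.+ + d) * B (i t ℤ.+ + d) (i t)

    split : ∀ d t → cutTerm A (B ·L[ a ]) d t ≈ diagonal d t + right d t
    split d t = ≈-trans (distribˡ _ _ _) (+-congʳ (≈-trans (≈-sym (*-assoc _ _ _)) (*-comm _ _)))

    merge : ∀ d t → cutTerm (L[ a ]· A) B d t ≈ diagonal d t + left d t
    merge d t = ≈-trans (distribʳ _ _ _) (+-congʳ (*-assoc _ _ _))

    drop-last : ∑△ (suc N) diagonal ≈ ∑△ N diagonal
    drop-last = ≈-trans (+-congˡ (∑-zero N _ λ t _ → ≈-trans (*-congˡ (*-congˡ (bounded-vanishes B-bounded ℕ.≤-refl (i t))))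
                                                       (≈-trans (*-congˡ (zeroʳ _)) (zeroʳ _))))
                        (+-identityʳ _)

    shift : ∀ d t → right (suc d) (suc t) ≡ left d t
    shift d t = ≡.trans (cong (λ k → A k (k ℤ.+ + suc d) * B (k ℤ.+ + suc d) (ℤ.suc k)) (ℤ.neg-suc t))
                        (cong₂ (λ j k → A (ℤ.pred (i t)) j * B j k) (pred[i]+[1+n]≡i+n (i t) d) (ℤ.suc-pred (i t)))

  edgeSum-telescope : ∀ N a A B → B (+ 0) (+ 1) ≈ 0# → BoundedBy R N B →
                      edgeSum (suc N) A (L[ a ]· B) ≈ edgeSum N (A ·L[ a ]) B
  edgeSum-telescope N a A B B01≈0 B-bounded = begin
    edgeSum (suc N) A (L[ a ]· B)
      ≈⟨ ∑-cong (suc N) (λ d _ → ≈-trans (distribˡ _ _ _) (+-congʳ (≈-sym (*-assoc _ _ _)))) ⟩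
    ∑[ d < suc N ] (diagonal d + below d)
      ≈⟨ ∑-+ (suc N) diagonal below ⟩
    ∑ (suc N) diagonal + ∑ (suc N) below
      ≈⟨ +-cong drop-last (≈-trans (∑-suc N below) drop-first) ⟩
    ∑ N diagonal + ∑[ d < N ] above d
      ≈⟨ ≈-sym (≈-trans (∑-cong N λ d _ → distribʳ _ _ _) (∑-+ N diagonal above)) ⟩
    edgeSum N (A ·L[ a ]) B ∎
    where
    diagonal below above : ℕ → Carrier
    diagonal d = A (+ 0) (+ suc d) * a (+ suc d) * B (+ suc d) (+ 1)
    below    d = A (+ 0) (+ suc d) * B (+ d) (+ 1)
    above    d = A (+ 0) (+ suc (suc d)) * B (+ suc d) (+ 1)

    drop-last : ∑ (suc N) diagonal ≈ ∑ N diagonal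
    drop-last = ≈-trans (+-congˡ (≈-trans (*-congˡ (bounded-vanishes B-bounded ℕ.≤-refl (+ 1))) (zeroʳ _)))
                        (+-identityʳ _)

    drop-first : below 0 + ∑ N above ≈ ∑ N above
    drop-first = ≈-trans (+-congʳ (≈-trans (*-congˡ B01≈0) (zeroʳ _))) (+-identityˡ _)

  δ : ℕ → ℕ → Carrier
  δ zero    zero    = 1#
  δ zero    (suc m) = 0#
  δ (suc k) zero    = 0#
  δ (suc k) (suc m) = δ k m

  δ-diagonal : ∀ k x → δ k k * x ≈ x
  δ-diagonal zero    x = *-identityˡ x
  δ-diagonal (suc k) x = δ-diagonal k x

  δ-off-diagonal : ∀ {k m} → k ≢ m → ∀ x → δ k m * x ≈ 0#
  δ-off-diagonal {zero}  {zero}  k≢m x = ⊥-elim (k≢m ≡.refl)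
  δ-off-diagonal {zero}  {suc m} k≢m x = zeroˡ x
  δ-off-diagonal {suc k} {zero}  k≢m x = zeroˡ x
  δ-off-diagonal {suc k} {suc m} k≢m x = δ-off-diagonal (k≢m ∘ cong suc) x

  -- The matrices J_k

  module _ (α : ℤ → Carrier) where

    J⁺ J⁻ : ℕ → Mat R
    J⁺ k = J R α (+ k)
    J⁻ m = J R α (ℤ.- + m)

    private
      nonpositive : ∀ m → ⌊ + 0 ℤ.<? ℤ.- + m ⌋ ≡ false
      nonpositive zero    = ≡.refl
      nonpositive (suc m) = ≡.refl

    J⁻-lower : ∀ m → LowerTriangular (J⁻ m)
    J⁻-lower m i n rewrite nonpositive m with i ℤ.+ + suc n ℤ.≤? i
    ... | yes i+1+n≤i = ⊥-elim (i+[1+n]≰i i n i+1+n≤i)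
    ... | no  _       = ≈-refl

    J⁻-entry : ∀ m s j {i} → i ≡ j ℤ.+ + s →
                    J⁻ m i j ≈ compᶻ (m ⊖ s) (map α (range j (suc s)))
    J⁻-entry m s j ≡.refl rewrite nonpositive m with j ℤ.≤? j ℤ.+ + s
    ... | no  j≰j+s = ⊥-elim (j≰j+s (ℤ.i≤i+j j (+ s)))
    ... | yes _     = ≈-reflexive (≡.trans (if-≤?-extendℤ _ (reorder (j ℤ.+ + s) j (ℤ.- + m)))
                                           (cong₂ (λ d L → compᶻ d (map α L)) degree columns))
      where
      reorder : ∀ i j k → j ℤ.- i ℤ.- k ≡ j ℤ.- k ℤ.- i
      reorder = solve-∀
      cancel : ∀ j S M → j ℤ.- (j ℤ.+ S) ℤ.- ℤ.- M ≡ M ℤ.- S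
      cancel = solve-∀
      degree : j ℤ.- (j ℤ.+ + s) ℤ.- ℤ.- + m ≡ m ⊖ s
      degree = ≡.trans (cancel j (+ s) (+ m)) (ℤ.m-n≡m⊖n m s)
      columns : range j (suc ∣ j ℤ.+ + s ℤ.- j ∣) ≡ range j (suc s)
      columns = cong (λ n → range j (suc ∣ n ∣)) ([i+n]-i≡n j s)

    J⁺-entry : ∀ k n i {j} → j ≡ i ℤ.+ + suc n →
                    J⁺ k i j ≈ elemᶻ (suc n ⊖ k) (map (λ m → - α m) (range (ℤ.suc i) n))
    J⁺-entry zero    n i ≡.refl =
      ≈-trans (J⁻-lower 0 i n) (≈-sym (elem-length (suc n) xs (ℕ.≤-reflexive (cong suc length≡n))))
      where
      xs = map (λ m → - α m) (range (ℤ.suc i) n)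
      length≡n : length xs ≡ n
      length≡n = ≡.trans (length-map _ (range (ℤ.suc i) n)) (length-range (ℤ.suc i) n)
    J⁺-entry (suc k) n i ≡.refl =
      ≈-reflexive (≡.trans (if-≤?-extendℤ _ (reorder i (i ℤ.+ + suc n) (+ suc k)))
                           (cong₂ (λ d L → elemᶻ d (map (λ m → - α m) L)) degree columns))
      where
      reorder : ∀ i j k → j ℤ.- i ℤ.- k ≡ j ℤ.- (i ℤ.+ k)
      reorder = solve-∀
      degree : i ℤ.+ + suc n ℤ.- i ℤ.- + suc k ≡ suc n ⊖ suc k
      degree = ≡.trans (cong (ℤ._- + suc k) ([i+n]-i≡n i (suc n))) (ℤ.m-n≡m⊖n (suc n) (suc k))
      columns : range (i ℤ.+ + 1) ∣ i ℤ.+ + suc n ℤ.- i ℤ.- + 1 ∣ ≡ range (ℤ.suc i) n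
      columns = cong₂ range (ℤ.+-comm i (+ 1)) (cong (λ z → ∣ z ℤ.- + 1 ∣) ([i+n]-i≡n i (suc n)))

    J⁺-upper : ∀ k → UpperTriangular (J⁺ k)
    J⁺-upper zero    i n = J⁻-entry 0 (suc n) i ≡.refl
    J⁺-upper (suc k) i n with i ℤ.+ + suc n ℤ.+ + suc k ℤ.≤? i
    ... | yes p = ⊥-elim (i+[1+n]≰i i (n ℕ.+ suc k) (≡.subst (ℤ._≤ i) (ℤ.+-assoc i (+ suc n) (+ suc k)) p))
    ... | no  _ = ≈-refl

    J⁻-bounded : ∀ {m N} → m ℕ.< N → BoundedBy R N (J⁻ m)
    J⁻-bounded {m} {N} m<N i j N≤i-j = begin
      J⁻ m i j                   ≈⟨ J⁻-entry m s j i≡j+s ⟩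
      compᶻ (m ⊖ s) (map α (range j (suc s))) ≡⟨ extendℤ-negative _ m⊖s<0 ⟩
      0#                                    ∎
      where
      s = ∣ i ℤ.- j ∣
      +s≡i-j : + s ≡ i ℤ.- j
      +s≡i-j = ℤ.0≤i⇒+∣i∣≡i (ℤ.≤-trans (ℤ.+≤+ z≤n) N≤i-j)
      j+[i-j]≡i : ∀ i j → j ℤ.+ (i ℤ.- j) ≡ i
      j+[i-j]≡i = solve-∀
      i≡j+s : i ≡ j ℤ.+ + s
      i≡j+s = ≡.trans (≡.sym (j+[i-j]≡i i j)) (cong (λ x → j ℤ.+ x) (≡.sym +s≡i-j))
      m<s : m ℕ.< s
      m<s = ℕ.<-≤-trans m<N (ℤ.drop‿+≤+ (≡.subst (+ N ℤ.≤_) (≡.sym +s≡i-j) N≤i-j))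
      m⊖s<0 : m ⊖ s ℤ.< + 0
      m⊖s<0 = ≡.subst (m ⊖ s ℤ.<_) (ℤ.n⊖n≡0 m) (ℤ.⊖-monoʳ->-< m m<s)

    J⁺-L· : ∀ k i n → J⁺ k i (i ℤ.+ + suc n) ≈ (L[ α ]· J⁺ (suc k)) i (i ℤ.+ + suc n)
    J⁺-L· k i n = begin
      J⁺ k i j                                      ≈⟨ J⁺-entry k n i ≡.refl ⟩
      e₀                                                   ≈⟨ a*b+[c-a*b]≈c (α i) e₁ e₀ ⟨
      α i * e₁ + (e₀ + - α i * e₁)                         ≈⟨ +-cong (*-congˡ (J⁺-entry (suc k) n i ≡.refl)) shifted ⟨
      α i * J⁺ (suc k) i j + J⁺ (suc k) (ℤ.pred i) j ∎
      where
      j  = i ℤ.+ + suc n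
      xs = map (λ m → - α m) (range (ℤ.suc i) n)
      e₀ = elemᶻ (suc n ⊖ k) xs
      e₁ = elemᶻ (suc n ⊖ suc k) xs
      shifted : J⁺ (suc k) (ℤ.pred i) j ≈ e₀ + - α i * e₁
      shifted = begin
        J⁺ (suc k) (ℤ.pred i) j
          ≈⟨ J⁺-entry (suc k) (suc n) (ℤ.pred i) (≡.sym (pred[i]+[1+n]≡i+n i (suc n))) ⟩
        elemᶻ (suc (suc n) ⊖ suc k) (map (λ m → - α m) (range (ℤ.suc (ℤ.pred i)) (suc n)))
          ≡⟨ cong₂ elemᶻ (ℤ.[1+m]⊖[1+n]≡m⊖n (suc n) k)
                         (cong (map (λ m → - α m)) (≡.trans (cong (λ i′ → range i′ (suc n)) (ℤ.suc-pred i)) (range-∷ i n))) ⟩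
        elemᶻ (suc n ⊖ k) (- α i ∷ xs)                     ≈⟨ elemᶻ-∷ (suc n ⊖ k) (- α i) xs ⟩
        e₀ + - α i * elemᶻ (ℤ.pred (suc n ⊖ k)) xs         ≡⟨ cong (λ d → e₀ + - α i * elemᶻ d xs) (pred[m⊖n]≡m⊖[1+n] (suc n) k) ⟩
        e₀ + - α i * e₁                                    ∎

    J⁺-·L : ∀ k i n → J⁺ k i (i ℤ.+ + suc n) ≈ (J⁺ (suc k) ·L[ α ]) i (i ℤ.+ + suc n)
    J⁺-·L k i n = begin
      J⁺ k i j                                      ≈⟨ J⁺-entry k n i ≡.refl ⟩
      e₀                                                   ≈⟨ a*b+[c-a*b]≈c (α j) e₁ e₀ ⟨
      α j * e₁ + (e₀ + - α j * e₁)                         ≈⟨ +-congʳ (*-comm (α j) e₁) ⟩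
      e₁ * α j + (e₀ + - α j * e₁)                         ≈⟨ +-cong (*-congʳ (J⁺-entry (suc k) n i ≡.refl)) extended ⟨
      J⁺ (suc k) i j * α j + J⁺ (suc k) i (ℤ.suc j) ∎
      where
      j  = i ℤ.+ + suc n
      xs = map (λ m → - α m) (range (ℤ.suc i) n)
      e₀ = elemᶻ (suc n ⊖ k) xs
      e₁ = elemᶻ (suc n ⊖ suc k) xs
      extended : J⁺ (suc k) i (ℤ.suc j) ≈ e₀ + - α j * e₁
      extended = begin
        J⁺ (suc k) i (ℤ.suc j)
          ≈⟨ J⁺-entry (suc k) (suc n) i (suc[i+n]≡i+[1+n] i (suc n)) ⟩
        elemᶻ (suc (suc n) ⊖ suc k) (map (λ m → - α m) (range (ℤ.suc i) (suc n)))
          ≡⟨ cong₂ elemᶻ (ℤ.[1+m]⊖[1+n]≡m⊖n (suc n) k)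
                         (≡.trans (cong (map (λ m → - α m)) (range-∷ʳ (ℤ.suc i) n))
                                  (≡.trans (map-++ _ (range (ℤ.suc i) n) _) (cong (λ x → xs ∷ʳ - α x) (suc[i]+n≡i+[1+n] i n)))) ⟩
        elemᶻ (suc n ⊖ k) (xs ∷ʳ - α j)                    ≈⟨ elemᶻ-∷ʳ (suc n ⊖ k) xs (- α j) ⟩
        e₀ + - α j * elemᶻ (ℤ.pred (suc n ⊖ k)) xs         ≡⟨ cong (λ d → e₀ + - α j * elemᶻ d xs) (pred[m⊖n]≡m⊖[1+n] (suc n) k) ⟩
        e₀ + - α j * e₁                                    ∎

    J⁻-·L : ∀ m i n → J⁻ (suc m) (i ℤ.+ + suc n) i ≈ (J⁻ m ·L[ α ]) (i ℤ.+ + suc n) i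
    J⁻-·L m i n = begin
      J⁻ (suc m) j i                                   ≈⟨ J⁻-entry (suc m) (suc n) i ≡.refl ⟩
      compᶻ (suc m ⊖ suc n) (map α (range i (suc (suc n))))
        ≡⟨ cong₂ compᶻ (ℤ.[1+m]⊖[1+n]≡m⊖n m n) (cong (map α) (range-∷ i (suc n))) ⟩
      compᶻ (m ⊖ n) (α i ∷ ys)                             ≈⟨ compᶻ-∷ (m ⊖ n) (α i) ys ⟩
      c₁ + α i * compᶻ (ℤ.pred (m ⊖ n)) (α i ∷ ys)         ≡⟨ cong (λ d → c₁ + α i * compᶻ d (α i ∷ ys)) (pred[m⊖n]≡m⊖[1+n] m n) ⟩
      c₁ + α i * c₀                                        ≈⟨ ≈-trans (+-comm _ _) (+-congʳ (*-comm _ _)) ⟩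
      c₀ * α i + c₁                                        ≈⟨ +-cong (*-congʳ diagonal) column ⟨
      J⁻ m j i * α i + J⁻ m j (ℤ.suc i) ∎
      where
      j  = i ℤ.+ + suc n
      ys = map α (range (ℤ.suc i) (suc n))
      c₀ = compᶻ (m ⊖ suc n) (α i ∷ ys)
      c₁ = compᶻ (m ⊖ n) ys
      diagonal : J⁻ m j i ≈ c₀
      diagonal = ≈-trans (J⁻-entry m (suc n) i ≡.refl) (≈-reflexive (cong (compᶻ (m ⊖ suc n) ∘ map α) (range-∷ i (suc n))))
      column : J⁻ m j (ℤ.suc i) ≈ c₁
      column = J⁻-entry m n (ℤ.suc i) (≡.sym (suc[i]+n≡i+[1+n] i n))

    J⁻-L· : ∀ m j s → J⁻ (suc m) (j ℤ.+ + s) j ≈ (L[ α ]· J⁻ m) (j ℤ.+ + s) j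
    J⁻-L· m j zero = begin
      J⁻ (suc m) (j ℤ.+ + 0) j                         ≈⟨ J⁻-entry (suc m) 0 j ≡.refl ⟩
      0# + α j * comp R m (α j ∷ [])                       ≈⟨ +-comm _ _ ⟩
      α j * comp R m (α j ∷ []) + 0#
        ≈⟨ +-cong (*-cong (≈-reflexive (cong α (ℤ.+-identityʳ j))) (J⁻-entry m 0 j ≡.refl)) above ⟨
      α (j ℤ.+ + 0) * J⁻ m (j ℤ.+ + 0) j + J⁻ m (ℤ.pred (j ℤ.+ + 0)) j ∎
      where
      above : J⁻ m (ℤ.pred (j ℤ.+ + 0)) j ≈ 0#
      above = ≈-trans (≈-reflexive (cong (J⁻ m (ℤ.pred (j ℤ.+ + 0))) (≡.sym column))) (J⁻-lower m (ℤ.pred (j ℤ.+ + 0)) 0)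
        where column = ≡.trans (pred[i]+[1+n]≡i+n (j ℤ.+ + 0) 0) (≡.trans (ℤ.+-identityʳ _) (ℤ.+-identityʳ j))
    J⁻-L· m j (suc s) = begin
      J⁻ (suc m) i j                                   ≈⟨ J⁻-entry (suc m) (suc s) j ≡.refl ⟩
      compᶻ (suc m ⊖ suc s) (map α (range j (suc (suc s)))) ≡⟨ cong₂ compᶻ (ℤ.[1+m]⊖[1+n]≡m⊖n m s) columns ⟩
      compᶻ (m ⊖ s) (zs ∷ʳ α i)                            ≈⟨ compᶻ-∷ʳ (m ⊖ s) zs (α i) ⟩
      compᶻ (m ⊖ s) zs + α i * compᶻ (ℤ.pred (m ⊖ s)) (zs ∷ʳ α i) ≈⟨ +-comm _ _ ⟩
      α i * compᶻ (ℤ.pred (m ⊖ s)) (zs ∷ʳ α i) + compᶻ (m ⊖ s) zs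
        ≈⟨ +-cong (*-congˡ diagonal) (J⁻-entry m s j (pred[i+[1+n]]≡i+n j s)) ⟨
      α i * J⁻ m i j + J⁻ m (ℤ.pred i) j ∎
      where
      i  = j ℤ.+ + suc s
      zs = map α (range j (suc s))
      columns : map α (range j (suc (suc s))) ≡ zs ∷ʳ α i
      columns = ≡.trans (cong (map α) (range-∷ʳ j (suc s))) (map-++ α (range j (suc s)) _)
      diagonal : J⁻ m i j ≈ compᶻ (ℤ.pred (m ⊖ s)) (zs ∷ʳ α i)
      diagonal = ≈-trans (J⁻-entry m (suc s) j ≡.refl) (≈-reflexive (cong₂ compᶻ (≡.sym (pred[m⊖n]≡m⊖[1+n] m s)) columns))

    edgeSum-J-step : ∀ k m → edgeSum (suc (suc m)) (J⁺ (suc k)) (J⁻ (suc m)) ≈ edgeSum (suc m) (J⁺ k) (J⁻ m)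
    edgeSum-J-step k m = begin
      edgeSum (suc (suc m)) (J⁺ (suc k)) (J⁻ (suc m))
        ≈⟨ edgeSum-cong (suc (suc m)) (J⁺ (suc k)) (J⁺ (suc k)) (J⁻ (suc m)) (L[ α ]· J⁻ m)
                        (λ _ → ≈-refl) (J⁻-L· m (+ 1)) ⟩
      edgeSum (suc (suc m)) (J⁺ (suc k)) (L[ α ]· J⁻ m)
        ≈⟨ edgeSum-telescope (suc m) α (J⁺ (suc k)) (J⁻ m) (J⁻-lower m (+ 0) 0) (J⁻-bounded ℕ.≤-refl) ⟩
      edgeSum (suc m) (J⁺ (suc k) ·L[ α ]) (J⁻ m)
        ≈⟨ edgeSum-cong (suc m) (J⁺ k) (J⁺ (suc k) ·L[ α ]) (J⁻ m) (J⁻ m) (J⁺-·L k (+ 0)) (λ _ → ≈-refl) ⟨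
      edgeSum (suc m) (J⁺ k) (J⁻ m) ∎

    edgeSum-J : ∀ k m → edgeSum (suc m) (J⁺ (suc k)) (J⁻ m) ≈ δ k m
    edgeSum-J k       zero    = ≈-trans (+-identityˡ _) (≈-trans (*-cong (corner k) (J⁻-entry 0 0 (+ 1) ≡.refl)) (*-identityʳ _))
      where
      corner : ∀ k → J⁺ (suc k) (+ 0) (+ 1) ≈ δ k 0
      corner zero    = J⁺-entry 1 0 (+ 0) ≡.refl
      corner (suc k) = J⁺-entry (suc (suc k)) 0 (+ 0) ≡.refl
    edgeSum-J zero    (suc m) = ≈-trans (edgeSum-J-step 0 m)
                                        (∑-zero (suc m) _ λ d _ → ≈-trans (*-congʳ (J⁻-lower 0 (+ 0) d)) (zeroˡ _))
    edgeSum-J (suc k) (suc m) = ≈-trans (edgeSum-J-step (suc k) m) (edgeSum-J k m)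

    cutSum-J-step : ∀ k m → cutSum (suc (suc m)) (J⁺ (suc k)) (J⁻ (suc m)) ≈
                            cutSum (suc m) (J⁺ k) (J⁻ m) + edgeSum (suc m) (J⁺ (suc k)) (J⁻ m)
    cutSum-J-step k m = begin
      cutSum (suc (suc m)) (J⁺ (suc k)) (J⁻ (suc m))
        ≈⟨ cutSum-cong (suc (suc m)) (J⁺ (suc k)) (J⁺ (suc k)) (J⁻ (suc m)) (J⁻ m ·L[ α ])
                       (λ _ _ → ≈-refl) (J⁻-·L m) ⟩
      cutSum (suc (suc m)) (J⁺ (suc k)) (J⁻ m ·L[ α ])
        ≈⟨ cutSum-telescope (suc m) α (J⁺ (suc k)) (J⁻ m) (J⁻-bounded ℕ.≤-refl) ⟩
      cutSum (suc m) (L[ α ]· J⁺ (suc k)) (J⁻ m) + edgeSum (suc m) (J⁺ (suc k)) (J⁻ m)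
        ≈⟨ +-congʳ (cutSum-cong (suc m) (J⁺ k) (L[ α ]· J⁺ (suc k)) (J⁻ m) (J⁻ m) (J⁺-L· k) (λ _ _ → ≈-refl)) ⟨
      cutSum (suc m) (J⁺ k) (J⁻ m) + edgeSum (suc m) (J⁺ (suc k)) (J⁻ m) ∎

    cutSum-J : ∀ k m → cutSum (suc m) (J⁺ k) (J⁻ m) ≈ δ k m * natCast R k
    cutSum-J zero    m       = ≈-trans (cutSum-lower (suc m) (J⁺ 0) (J⁻ m) (J⁻-lower 0)) (≈-sym (zeroʳ _))
    cutSum-J (suc k) zero    = ≈-trans (cutSum-upper 1 (J⁺ (suc k)) (J⁻ 0) (J⁺-upper 0)) (≈-sym (zeroˡ _))
    cutSum-J (suc k) (suc m) = begin
      cutSum (suc (suc m)) (J⁺ (suc k)) (J⁻ (suc m))        ≈⟨ cutSum-J-step k m ⟩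
      cutSum (suc m) (J⁺ k) (J⁻ m) + edgeSum (suc m) (J⁺ (suc k)) (J⁻ m)
                                                            ≈⟨ +-cong (cutSum-J k m) (edgeSum-J k m) ⟩
      δ k m * natCast R k + δ k m                           ≈⟨ +-comm _ _ ⟩
      δ k m + δ k m * natCast R k                           ≈⟨ +-congʳ (*-identityʳ _) ⟨
      δ k m * 1# + δ k m * natCast R k                      ≈⟨ distribˡ _ _ _ ⟨
      δ k m * natCast R (suc k)                             ∎

    cutSum-J-bounded : ∀ k m N → BoundedBy R N (J⁻ (suc m)) →
                       cutSum N (J⁺ (suc k)) (J⁻ (suc m)) ≈ δ k m * natCast R (suc k)
    cutSum-J-bounded k m N N-bound =
      ≈-trans (cutSum-bound-irrelevant (J⁺ (suc k)) N-bound (J⁻-bounded {suc m} ℕ.≤-refl)) (cutSum-J (suc k) (suc m))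

    φ-J-cross : ∀ k m NA NB → BoundedBy R NB (J⁻ (suc m)) →
                φ R NA NB (J⁺ (suc k)) (J⁻ (suc m)) ≈ δ k m * natCast R (suc k)
    φ-J-cross k m NA NB NB-bound = begin
      φ R NA NB (J⁺ (suc k)) (J⁻ (suc m))
        ≈⟨ φ≈cutSum-cutSum NA NB (J⁺ (suc k)) (J⁻ (suc m)) ⟩
      cutSum NB (J⁺ (suc k)) (J⁻ (suc m)) - cutSum NA (J⁻ (suc m)) (J⁺ (suc k))
        ≈⟨ +-cong (cutSum-J-bounded k m NB NB-bound) (-‿cong (cutSum-upper NA (J⁻ (suc m)) (J⁺ (suc k)) (J⁺-upper (suc k)))) ⟩
      δ k m * natCast R (suc k) - 0#
        ≈⟨ ≈-trans (+-congˡ -0#≈0#) (+-identityʳ _) ⟩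
      δ k m * natCast R (suc k) ∎

    φ-J-cross′ : ∀ k m NA NB → BoundedBy R NA (J⁻ (suc m)) →
                 φ R NA NB (J⁻ (suc m)) (J⁺ (suc k)) ≈ - (δ k m * natCast R (suc k))
    φ-J-cross′ k m NA NB NA-bound = begin
      φ R NA NB (J⁻ (suc m)) (J⁺ (suc k))
        ≈⟨ φ≈cutSum-cutSum NA NB (J⁻ (suc m)) (J⁺ (suc k)) ⟩
      cutSum NB (J⁻ (suc m)) (J⁺ (suc k)) - cutSum NA (J⁺ (suc k)) (J⁻ (suc m))
        ≈⟨ +-cong (cutSum-lower NB (J⁻ (suc m)) (J⁺ (suc k)) (J⁻-lower (suc m))) (-‿cong (cutSum-J-bounded k m NA NA-bound)) ⟩
      0# - δ k m * natCast R (suc k)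
        ≈⟨ +-identityˡ _ ⟩
      - (δ k m * natCast R (suc k)) ∎

    φ-J-opposite : ∀ k NA NB → BoundedBy R NA (J R α k) → BoundedBy R NB (J R α (ℤ.- k)) →
                   φ R NA NB (J R α k) (J R α (ℤ.- k)) ≈ intCast R k
    φ-J-opposite (+ zero)  NA NB _        _        = φ-lower NA NB (J⁻ 0) (J⁻ 0) (J⁻-lower 0) (J⁻-lower 0)
    φ-J-opposite (+ suc k) NA NB _        NB-bound = ≈-trans (φ-J-cross k k NA NB NB-bound) (δ-diagonal k _)
    φ-J-opposite -[1+ k ]  NA NB NA-bound _        = ≈-trans (φ-J-cross′ k k NA NB NA-bound) (-‿cong (δ-diagonal k _))

    φ-J-non-opposite : ∀ k l NA NB → l ≢ ℤ.- k → BoundedBy R NA (J R α k) → BoundedBy R NB (J R α l) →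
                       φ R NA NB (J R α k) (J R α l) ≈ 0#
    φ-J-non-opposite (+ k)     (+ l)     NA NB _    _        _        =
      φ-upper NA NB (J⁺ k) (J⁺ l) (J⁺-upper k) (J⁺-upper l)
    φ-J-non-opposite (+ zero)  -[1+ m ]  NA NB _    _        _        =
      φ-lower NA NB (J⁻ 0) (J⁻ (suc m)) (J⁻-lower 0) (J⁻-lower (suc m))
    φ-J-non-opposite (+ suc k) -[1+ m ]  NA NB l≢-k _        NB-bound =
      ≈-trans (φ-J-cross k m NA NB NB-bound) (δ-off-diagonal (λ k≡m → l≢-k (cong -[1+_] (≡.sym k≡m))) _)
    φ-J-non-opposite -[1+ m ]  (+ zero)  NA NB _    _        _        =
      φ-lower NA NB (J⁻ (suc m)) (J⁻ 0) (J⁻-lower (suc m)) (J⁻-lower 0)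
    φ-J-non-opposite -[1+ m ]  (+ suc l) NA NB l≢-k NA-bound _        =
      ≈-trans (φ-J-cross′ l m NA NB NA-bound)
              (≈-trans (-‿cong (δ-off-diagonal (λ l≡m → l≢-k (cong (λ n → + suc n) l≡m)) _)) -0#≈0#)
    φ-J-non-opposite -[1+ m ]  -[1+ l ]  NA NB _    _        _        =
      φ-lower NA NB (J⁻ (suc m)) (J⁻ (suc l)) (J⁻-lower (suc m)) (J⁻-lower (suc l))

open import Data.Integer using (-_; _≟_)

proposition3p6 : ∀ {c ℓ} (R : CommutativeRing c ℓ) (α : ℤ → CommutativeRing.Carrier R)
    (k l : ℤ) (NA NB : ℕ)
    → BoundedBy R NA (J R α k) → BoundedBy R NB (J R α l)
    → CommutativeRing._≈_ R (φ R NA NB (J R α k) (J R α l))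
        (if ⌊ l ≟ - k ⌋ then intCast R k else CommutativeRing.0# R)
proposition3p6 R α k l NA NB A-bound B-bound with l ≟ - k
... | yes ≡.refl = φ-J-opposite R α k NA NB A-bound B-bound
... | no  l≢-k   = φ-J-non-opposite R α k l NA NB l≢-k A-bound B-bound
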